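{- Let $Y$ be a finite set of positive integers and let $w=x_1x_2\cdots x_n$ be an Andr\'e I permutation of $Y$. Then $\theta(w):=(x_n-x_{n-1})(x_n-x_{n-2})\cdots(x_n-x_1)\,x_n$ is also an Andr\'e I permutation (of its set of letters).
   Context: Words are permutations of finite sets $Y$ of positive integers. Andr\'e I permutations: the empty word and one-letter words are Andr\'e I; for $|Y|\ge2$ write $w=v\,\min(w)\,v'$; $w$ is Andr\'e I if $v,v'$ are Andr\'e I and $\max(vv')$ is a letter of $v'$. -}

module Defs where

open import Data.Nat using (ℕ; _<_; _≤_; _∸_)
open import Data.List using (List; []; _∷_; [_]; _++_; map; reverse; _∷ʳ_)
open import Data.List.Relation.Unary.All using (All)
open import Data.List.Relation.Unary.Unique.Propositional using (Unique)
open import Data.List.Membership.Propositional using (_∈_)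
open import Data.Product using (Σ; _×_)

-- A word is a list of natural numbers. It is a permutation of a finite set
-- of positive integers (namely its set of letters) iff its letters are
-- pairwise distinct and positive.
IsPermOfPositiveSet : List ℕ → Set
IsPermOfPositiveSet w = Unique w × All (λ x → 0 < x) w

data AndreI : List ℕ → Set where
  andre-nil    : AndreI []
  andre-single : (x : ℕ) → AndreI [ x ]
  andre-split  : (v : List ℕ) (m : ℕ) (v' : List ℕ) →
                 All (λ y → m < y) (v ++ v') →
                 AndreI v → AndreI v' →
                 Σ ℕ (λ M → (M ∈ v') × All (λ y → y ≤ M) (v ++ v')) →
                 AndreI (v ++ m ∷ v')

-- θ(x₁ ⋯ x_{n-1} x_n) = (x_n - x_{n-1}) ⋯ (x_n - x₁) x_n,
-- the nonempty word w being written as xs ∷ʳ xn.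
θ : List ℕ → ℕ → List ℕ
θ xs xn = map (λ x → xn ∸ x) (reverse xs) ∷ʳ xn

-- The last letter M = x_n of an André I word is its maximum, so for w = u·M we have
-- θ(w) = mirror_M(u)·M, where mirror_M reverses u and replaces each letter x by M − x.
-- For u below M, u·M is André I iff u is a "stem": u = v m b with m = min u, v André I and
-- b a stem. A stem with distinct letters can also be decomposed at its maximum z, as
-- u = c z t with c a stem and t either empty or a letter below a stem. Mirroring reverses
-- both the word and the order of its letters, so it turns this decomposition at the maximum
-- into a decomposition of mirror_M(u) at its minimum; by induction mirror_M(u) is a stem,
-- and θ(w) is André I.

module Submission where

open import Defs
open import Data.Nat using (ℕ)
open import Data.List using (List; _∷ʳ_)
open import Data.Product using (_×_)

open import Data.Nat using (_<_; _≤_; _∸_; z<s)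
open import Data.Nat.Properties
  using (≤-refl; ≤-trans; <⇒≤; <⇒≢; ≤∧≢⇒<; <-trans; <-≤-trans; <-cmp; n<1+n; m<m+n; m≤n+m;
         ∸-monoʳ-<; ∸-cancelˡ-≡; m<n⇒0<n∸m)
open import Data.Nat.Induction using (<-wellFounded)
open import Data.List using ([]; _∷_; [_]; _++_; map; reverse; length; initLast; _∷ʳ′_)
open import Data.List.Properties using (++-assoc; ∷ʳ-injective; unfold-reverse; reverse-++; map-++; length-++)
open import Data.List.Relation.Unary.All as All using (All; []; _∷_)
open import Data.List.Relation.Unary.All.Properties using (++⁺; ++⁻ˡ; ++⁻ʳ; ∷ʳ⁺; ∷ʳ⁻; map⁺)
open import Data.List.Relation.Unary.Any using (here)
open import Data.List.Relation.Unary.AllPairs using ([]; _∷_)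
open import Data.List.Relation.Unary.Unique.Propositional using (Unique)
import Data.List.Relation.Unary.Unique.Propositional.Properties as Unique
open import Data.List.Relation.Binary.Permutation.Propositional using (↭-sym)
open import Data.List.Relation.Binary.Permutation.Propositional.Properties using (All-resp-↭; ↭-reverse)
open import Data.List.Membership.Propositional using (_∈_)
open import Data.List.Membership.Propositional.Properties using (∈-++⁺ʳ)
open import Data.Product using (_,_; proj₁; proj₂; ∃-syntax; uncurry)
open import Induction.WellFounded using (Acc; acc)
open import Relation.Binary.Definitions using (tri<; tri≈; tri>)
open import Relation.Binary.PropositionalEquality using (_≡_; _≢_; refl; sym; trans; cong; subst; module ≡-Reasoning)
open import Relation.Nullary using (contradiction)

private
  variable
    A : Set

All-++-∷⁻ : ∀ {P : A → Set} xs {y ys} → All P (xs ++ y ∷ ys) → All P xs × P y × All P ys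
All-++-∷⁻ xs ps with ++⁻ʳ xs ps
... | py ∷ pys = ++⁻ˡ xs ps , py , pys

Unique-++⁻ : ∀ (xs : List A) {ys} → Unique (xs ++ ys) →
             Unique xs × Unique ys × All (λ x → All (x ≢_) ys) xs
Unique-++⁻ []       u          = [] , u , []
Unique-++⁻ (x ∷ xs) (x∉xsys ∷ u) with Unique-++⁻ xs u
... | uxs , uys , xs#ys = ++⁻ˡ xs x∉xsys ∷ uxs , uys , ++⁻ʳ xs x∉xsys ∷ xs#ys

Unique-∷ʳ⁻ : ∀ {xs : List A} {x} → Unique (xs ∷ʳ x) → Unique xs × All (_≢ x) xs
Unique-∷ʳ⁻ {xs = xs} u with Unique-++⁻ xs u
... | uxs , _ , xs#x = uxs , All.map All.head xs#x

Unique-∷ʳ⁺ : ∀ {xs : List A} {x} → Unique xs → All (_≢ x) xs → Unique (xs ∷ʳ x)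
Unique-∷ʳ⁺ u xs≢x = Unique.++⁺ u ([] ∷ []) λ { (y∈xs , here refl) → All.lookup xs≢x y∈xs refl }

-- Stem u holds iff u·M is André I for some, equivalently every, M above all letters of u.
data Stem : List ℕ → Set where
  []        : Stem []
  min-split : ∀ v m b → All (m <_) (v ++ b) → AndreI v → Stem b → Stem (v ++ m ∷ b)

split-∷ʳ : ∀ (v : List A) {m v' u M x} → x ∈ v' → v ++ m ∷ v' ≡ u ∷ʳ M →
           ∃[ v'' ] v' ≡ v'' ∷ʳ M × u ≡ v ++ m ∷ v''
split-∷ʳ v {m} {v'} {u} x∈v' eq with initLast v'
split-∷ʳ v () eq | []
split-∷ʳ v {m} {u = u} x∈v' eq | v'' ∷ʳ′ y
  with u≡ , refl ← ∷ʳ-injective (v ++ m ∷ v'') u (trans (++-assoc v (m ∷ v'') [ y ]) eq)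
  = v'' , refl , sym u≡

Stem⇒AndreI : ∀ {u M} → Stem u → All (_< M) u → AndreI (u ∷ʳ M)
Stem⇒AndreI {M = M} [] [] = andre-single M
Stem⇒AndreI {M = M} (min-split v m b m<vb av sb) u<M
  with v<M , m<M , b<M ← All-++-∷⁻ v u<M =
  subst AndreI (sym (++-assoc v (m ∷ b) [ M ]))
    (andre-split v m (b ∷ʳ M) m<vbM av (Stem⇒AndreI sb b<M) (M , ∈-++⁺ʳ b (here refl) , vbM≤M))
  where
  m<vbM : All (m <_) (v ++ b ∷ʳ M)
  m<vbM = ++⁺ (++⁻ˡ v m<vb) (∷ʳ⁺ (++⁻ʳ v m<vb) m<M)
  vbM≤M : All (_≤ M) (v ++ b ∷ʳ M)
  vbM≤M = ++⁺ (All.map <⇒≤ v<M) (∷ʳ⁺ (All.map <⇒≤ b<M) ≤-refl)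

AndreI⇒Stem : ∀ {u M} → AndreI (u ∷ʳ M) → Stem u
AndreI⇒Stem a = go a refl
  where
  go : ∀ {w u M} → AndreI w → w ≡ u ∷ʳ M → Stem u
  go {u = []}    andre-nil        ()
  go {u = _ ∷ _} andre-nil        ()
  go {u = u}     (andre-single x) eq with refl , _ ← ∷ʳ-injective [] u eq = []
  go (andre-split v m v' m<vv' av av' (_ , max∈v' , _)) eq
    with v'' , refl , refl ← split-∷ʳ v max∈v' eq =
    min-split v m v'' (++⁺ (++⁻ˡ v m<vv') (++⁻ˡ v'' (++⁻ʳ v m<vv'))) av (go av' refl)

AndreI-∷ʳ-max : ∀ {u M} → AndreI (u ∷ʳ M) → All (_≤ M) u
AndreI-∷ʳ-max a = go a refl
  where
  go : ∀ {w u M} → AndreI w → w ≡ u ∷ʳ M → All (_≤ M) u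
  go {u = []}    andre-nil        ()
  go {u = _ ∷ _} andre-nil        ()
  go {u = u}     (andre-single x) eq with refl , _ ← ∷ʳ-injective [] u eq = []
  go {M = M} (andre-split v m v' m<vv' av av' (max , max∈v' , vv'≤max)) eq
    with v'' , refl , refl ← split-∷ʳ v max∈v' eq =
    ++⁺ (All.map (λ y≤max → ≤-trans y≤max max≤M) (++⁻ˡ v vv'≤max)) (<⇒≤ m<M ∷ v''≤M)
    where
    v''≤M : All (_≤ M) v''
    v''≤M = go av' refl
    max≤M : max ≤ M
    max≤M = All.lookup (∷ʳ⁺ v''≤M ≤-refl) max∈v'
    m<M : m < M
    m<M = <-≤-trans (All.lookup m<vv' (∈-++⁺ʳ v max∈v')) max≤M

AndreI-∷ʳ-max< : ∀ {u M} → AndreI (u ∷ʳ M) → Unique (u ∷ʳ M) → All (_< M) u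
AndreI-∷ʳ-max< a uq = All.zipWith (uncurry ≤∧≢⇒<) (AndreI-∷ʳ-max a , proj₂ (Unique-∷ʳ⁻ uq))

data EndsAtMax : List ℕ → Set where
  []       : EndsAtMax []
  last-max : ∀ {a x} → All (_< x) a → Stem a → EndsAtMax (a ∷ʳ x)

data StartsAtMin : List ℕ → Set where
  []       : StartsAtMin []
  head-min : ∀ {y d} → All (y <_) d → Stem d → StartsAtMin (y ∷ d)

data MaxSplit : List ℕ → Set where
  []        : MaxSplit []
  max-split : ∀ c z t → All (_< z) (c ++ t) → Stem c → StartsAtMin t → MaxSplit (c ++ z ∷ t)

AndreI⇒EndsAtMax : ∀ {v} → AndreI v → Unique v → EndsAtMax v
AndreI⇒EndsAtMax {v} av uv with initLast v
... | []       = []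
... | a ∷ʳ′ x  = last-max (AndreI-∷ʳ-max< av uv) (AndreI⇒Stem av)

max-split-∷ʳ : ∀ {a x m b} → All (_< x) a → Stem a → m < x → All (m <_) b → Stem b → All (_< x) b →
               MaxSplit ((a ∷ʳ x) ++ m ∷ b)
max-split-∷ʳ {a} {x} {m} {b} a<x sa m<x m<b sb b<x =
  subst MaxSplit (sym (++-assoc a [ x ] (m ∷ b)))
    (max-split a x (m ∷ b) (++⁺ a<x (m<x ∷ b<x)) sa (head-min m<b sb))

min-split⇒MaxSplit : ∀ {v m b} → All (m <_) (v ++ b) → AndreI v → EndsAtMax v →
                     Stem b → MaxSplit b → All (λ x → All (x ≢_) b) v → MaxSplit (v ++ m ∷ b)
min-split⇒MaxSplit {m = m} _ _ [] _ [] _ = max-split [] m [] [] [] []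
min-split⇒MaxSplit {m = m} m<b _ [] _ (max-split c z t z>ct sc st) _
  with m<c , m<z , _ ← All-++-∷⁻ c m<b =
  max-split (m ∷ c) z t (m<z ∷ z>ct) (min-split [] m c m<c andre-nil sc) st
min-split⇒MaxSplit {m = m} m<vb av (last-max {a} {x} a<x sa) sb [] v#b =
  max-split-∷ʳ a<x sa (proj₂ (∷ʳ⁻ (++⁻ˡ (a ∷ʳ x) m<vb))) [] sb []
min-split⇒MaxSplit {m = m} m<vb av (last-max {a} {x} a<x sa) sb (max-split c z t z>ct sc st) v#b
  with <-cmp x z
... | tri< x<z _ _ =
  subst MaxSplit (++-assoc (a ∷ʳ x) (m ∷ c) (z ∷ t))
    (max-split ((a ∷ʳ x) ++ m ∷ c) z t (++⁺ (++⁺ (∷ʳ⁺ a<z x<z) (<-trans m<x x<z ∷ c<z)) t<z)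
      (min-split (a ∷ʳ x) m c (++⁺ (++⁻ˡ (a ∷ʳ x) m<vb) (++⁻ˡ c m<b)) av sc) st)
  where
  m<x : m < x
  m<x = proj₂ (∷ʳ⁻ (++⁻ˡ (a ∷ʳ x) m<vb))
  m<b : All (m <_) (c ++ z ∷ t)
  m<b = ++⁻ʳ (a ∷ʳ x) m<vb
  a<z : All (_< z) a
  a<z = All.map (λ y<x → <-trans y<x x<z) a<x
  c<z : All (_< z) c
  c<z = ++⁻ˡ c z>ct
  t<z : All (_< z) t
  t<z = ++⁻ʳ c z>ct
... | tri≈ _ x≡z _ =
  contradiction x≡z (All.lookup (All.lookup v#b (∈-++⁺ʳ a (here refl))) (∈-++⁺ʳ c (here refl)))
... | tri> _ _ z<x =
  max-split-∷ʳ a<x sa (proj₂ (∷ʳ⁻ (++⁻ˡ (a ∷ʳ x) m<vb))) (++⁻ʳ (a ∷ʳ x) m<vb) sb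
    (++⁺ (All.map (λ y<z → <-trans y<z z<x) (++⁻ˡ c z>ct))
         (z<x ∷ All.map (λ y<z → <-trans y<z z<x) (++⁻ʳ c z>ct)))

Stem⇒MaxSplit : ∀ {u} → Stem u → Unique u → MaxSplit u
Stem⇒MaxSplit [] _ = []
Stem⇒MaxSplit (min-split v m b m<vb av sb) uq
  with uv , _ ∷ ub , v#mb ← Unique-++⁻ v uq =
  min-split⇒MaxSplit m<vb av (AndreI⇒EndsAtMax av uv) sb (Stem⇒MaxSplit sb ub) (All.map All.tail v#mb)

mirror : ℕ → List ℕ → List ℕ
mirror M u = map (M ∸_) (reverse u)

mirror-∷ : ∀ M y d → mirror M (y ∷ d) ≡ mirror M d ∷ʳ (M ∸ y)
mirror-∷ M y d = begin
  map (M ∸_) (reverse (y ∷ d))    ≡⟨ cong (map (M ∸_)) (unfold-reverse y d) ⟩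
  map (M ∸_) (reverse d ∷ʳ y)     ≡⟨ map-++ (M ∸_) (reverse d) [ y ] ⟩
  mirror M d ∷ʳ (M ∸ y)           ∎
  where open ≡-Reasoning

mirror-++-∷ : ∀ M c z t → mirror M (c ++ z ∷ t) ≡ mirror M t ++ (M ∸ z) ∷ mirror M c
mirror-++-∷ M c z t = begin
  map (M ∸_) (reverse (c ++ z ∷ t))              ≡⟨ cong (map (M ∸_)) (reverse-++ c (z ∷ t)) ⟩
  map (M ∸_) (reverse (z ∷ t) ++ reverse c)      ≡⟨ map-++ (M ∸_) (reverse (z ∷ t)) (reverse c) ⟩
  mirror M (z ∷ t) ++ mirror M c                 ≡⟨ cong (_++ mirror M c) (mirror-∷ M z t) ⟩
  (mirror M t ∷ʳ (M ∸ z)) ++ mirror M c          ≡⟨ ++-assoc (mirror M t) [ M ∸ z ] (mirror M c) ⟩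
  mirror M t ++ (M ∸ z) ∷ mirror M c             ∎
  where open ≡-Reasoning

All-mirror⁺ : ∀ {P : ℕ → Set} M {u} → All (λ x → P (M ∸ x)) u → All P (mirror M u)
All-mirror⁺ M {u} pu = map⁺ (All-resp-↭ (↭-sym (↭-reverse u)) pu)

Unique-mirror⁺ : ∀ M {u} → All (_≤ M) u → Unique u → Unique (mirror M u)
Unique-mirror⁺ M {[]}    _           _          = []
Unique-mirror⁺ M {x ∷ u} (x≤M ∷ u≤M) (x∉u ∷ uu) =
  subst Unique (sym (mirror-∷ M x u))
    (Unique-∷ʳ⁺ (Unique-mirror⁺ M u≤M uu)
      (All-mirror⁺ M (All.zipWith (λ (x≢y , y≤M) eq → x≢y (∸-cancelˡ-≡ x≤M y≤M (sym eq))) (x∉u , u≤M))))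

length-++-∷ : ∀ (c : List A) z t → length c < length (c ++ z ∷ t) × length t < length (c ++ z ∷ t)
length-++-∷ c z t rewrite length-++ c {z ∷ t} =
  m<m+n (length c) z<s , <-≤-trans (n<1+n (length t)) (m≤n+m _ (length c))

module _ (M : ℕ) where

  mirror-Stem-acc    : ∀ {u} → Acc _<_ (length u) → Stem u → Unique u → All (_< M) u → Stem (mirror M u)
  mirror-StartsAtMin : ∀ {t} → Acc _<_ (length t) → StartsAtMin t → Unique t → All (_< M) t →
                       AndreI (mirror M t)

  mirror-Stem-acc (acc rs) su uq u<M with Stem⇒MaxSplit su uq
  ... | [] = []
  ... | max-split c z t z>ct sc st
    with uc , _ ∷ ut , _ ← Unique-++⁻ c uq
       | c<M , z<M , t<M ← All-++-∷⁻ c u<M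
       | |c|< , |t|< ← length-++-∷ c z t =
    subst Stem (sym (mirror-++-∷ M c z t))
      (min-split (mirror M t) (M ∸ z) (mirror M c)
        (++⁺ (All-mirror⁺ M (All.map M∸z< (++⁻ʳ c z>ct))) (All-mirror⁺ M (All.map M∸z< (++⁻ˡ c z>ct))))
        (mirror-StartsAtMin (rs |t|<) st ut t<M)
        (mirror-Stem-acc (rs |c|<) sc uc c<M))
    where
    M∸z< : ∀ {y} → y < z → M ∸ z < M ∸ y
    M∸z< y<z = ∸-monoʳ-< y<z (<⇒≤ z<M)

  mirror-StartsAtMin _ [] _ _ = andre-nil
  mirror-StartsAtMin (acc rs) (head-min {y} {d} y<d sd) (_ ∷ ud) (_ ∷ d<M) =
    subst AndreI (sym (mirror-∷ M y d))
      (Stem⇒AndreI (mirror-Stem-acc (rs (n<1+n _)) sd ud d<M)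
        (All-mirror⁺ M (All.zipWith (λ (y<w , w<M) → ∸-monoʳ-< y<w (<⇒≤ w<M)) (y<d , d<M))))

mirror-Stem : ∀ M {u} → Stem u → Unique u → All (_< M) u → Stem (mirror M u)
mirror-Stem M = mirror-Stem-acc M (<-wellFounded _)

proposition2p3 : (xs : List ℕ) (xn : ℕ) →
    IsPermOfPositiveSet (xs ∷ʳ xn) → AndreI (xs ∷ʳ xn) →
    IsPermOfPositiveSet (θ xs xn) × AndreI (θ xs xn)
proposition2p3 xs xn (uq , pos) a =
  (Unique-∷ʳ⁺ (Unique-mirror⁺ xn (All.map <⇒≤ xs<xn) uxs) (All.map <⇒≢ mirror<xn) ,
   ∷ʳ⁺ (All-mirror⁺ xn (All.map m<n⇒0<n∸m xs<xn)) xn>0) ,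
  Stem⇒AndreI (mirror-Stem xn (AndreI⇒Stem a) uxs xs<xn) mirror<xn
  where
  uxs : Unique xs
  uxs = proj₁ (Unique-∷ʳ⁻ uq)
  xs<xn : All (_< xn) xs
  xs<xn = AndreI-∷ʳ-max< a uq
  xn>0 : 0 < xn
  xn>0 = proj₂ (∷ʳ⁻ pos)
  mirror<xn : All (_< xn) (mirror xn xs)
  mirror<xn = All-mirror⁺ xn (All.zipWith (λ (x>0 , x<xn) → ∸-monoʳ-< x>0 (<⇒≤ x<xn)) (proj₁ (∷ʳ⁻ pos) , xs<xn))
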